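{- Let $\mathbf{r}$ be such that $-\mathbf{r}\in\mathbb{N}^4$. Then the fourth characteristic ideal of $S_4^{\mathbf{r}}$ is not trivial; moreover $A_4(S_4^{\mathbf{r}},t)\subseteq\langle t+1,2\rangle$.
   Context: For a simple graph $G$ on $n$ vertices, $A_k(G,t)$ is the ideal of $\mathbb{Z}[t]$ generated by the $k\times k$ minors of $tI_n-A(G)$, where $A(G)$ is the adjacency matrix; it is trivial if it equals $\mathbb{Z}[t]$. $\mathbb{N}$ denotes the positive integers. For $-\mathbf{r}=(a_1,a_2,a_3,a_4)\in\mathbb{N}^4$, $S_4^{\mathbf{r}}$ is the graph obtained from the star $K_{1,3}$ with apex $v_1$ and leaves $v_2,v_3,v_4$ by replacing each $v_i$ by a clique of size $a_i$, two vertices in different cliques being adjacent iff the corresponding star vertices are adjacent. -}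

module Defs where

open import Data.Nat as ℕ using (ℕ; zero; suc)
open import Data.Integer as ℤ using (ℤ; +_; -[1+_])
open import Data.List using (List; []; _∷_)
open import Data.Fin as Fin using (Fin; zero; suc; splitAt; punchIn; toℕ)
open import Data.Bool using (Bool; true; false; if_then_else_; _∨_; _∧_; not)
open import Data.Sum using (inj₁; inj₂)
open import Relation.Nullary.Decidable using (⌊_⌋)
open import Relation.Binary.PropositionalEquality using (_≡_)

-- The polynomial ring ℤ[t]: coefficient lists, lowest degree first.

Poly : Set
Poly = List ℤ

coeff : Poly → ℕ → ℤ
coeff []       _       = + 0
coeff (a ∷ p)  zero    = a
coeff (a ∷ p)  (suc i) = coeff p i

-- equality in ℤ[t] (coefficientwise; trailing zeros irrelevant)
_≈ₚ_ : Poly → Poly → Set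
p ≈ₚ q = ∀ i → coeff p i ≡ coeff q i

infixl 6 _+ₚ_
infixl 7 _*ₚ_

_+ₚ_ : Poly → Poly → Poly
[]      +ₚ q       = q
(a ∷ p) +ₚ []      = a ∷ p
(a ∷ p) +ₚ (b ∷ q) = (a ℤ.+ b) ∷ (p +ₚ q)

scaleₚ : ℤ → Poly → Poly
scaleₚ c []      = []
scaleₚ c (a ∷ p) = (c ℤ.* a) ∷ scaleₚ c p

_*ₚ_ : Poly → Poly → Poly
[]      *ₚ q = []
(a ∷ p) *ₚ q = scaleₚ a q +ₚ (+ 0 ∷ (p *ₚ q))

-ₚ_ : Poly → Poly
-ₚ p = scaleₚ (ℤ.- (+ 1)) p

constₚ : ℤ → Poly
constₚ c = c ∷ []

0ₚ 1ₚ tₚ : Poly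
0ₚ = []
1ₚ = constₚ (+ 1)
tₚ = + 0 ∷ + 1 ∷ []

data ⟨_⟩ (S : Poly → Set) : Poly → Set where
  gen  : ∀ {p} → S p → ⟨ S ⟩ p
  zro  : ⟨ S ⟩ 0ₚ
  add  : ∀ {p q} → ⟨ S ⟩ p → ⟨ S ⟩ q → ⟨ S ⟩ (p +ₚ q)
  mul  : ∀ {p} (r : Poly) → ⟨ S ⟩ p → ⟨ S ⟩ (r *ₚ p)
  resp : ∀ {p q} → p ≈ₚ q → ⟨ S ⟩ p → ⟨ S ⟩ q

Trivial : (Poly → Set) → Set
Trivial I = ∀ p → I p

_⊆ᵢ_ : (Poly → Set) → (Poly → Set) → Set
I ⊆ᵢ J = ∀ p → I p → J p

data Gens-t+1,2 : Poly → Set where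
  g-t+1 : Gens-t+1,2 (tₚ +ₚ 1ₚ)
  g-2   : Gens-t+1,2 (constₚ (+ 2))

sumFin : ∀ {k} → (Fin k → Poly) → Poly
sumFin {zero}  f = 0ₚ
sumFin {suc k} f = f zero +ₚ sumFin (λ j → f (suc j))

signₚ : ℕ → Poly
signₚ zero          = 1ₚ
signₚ (suc zero)    = -ₚ 1ₚ
signₚ (suc (suc n)) = signₚ n

det : ∀ k → (Fin k → Fin k → Poly) → Poly
det zero    M = 1ₚ
det (suc k) M =
  sumFin (λ j → signₚ (toℕ j) *ₚ M zero j *ₚ det k (λ r c → M (suc r) (punchIn j c)))

StrictlyIncreasing : ∀ {k n} → (Fin k → Fin n) → Set
StrictlyIncreasing f = ∀ i j → i Fin.< j → f i Fin.< f j

data Minor (k : ℕ) {n : ℕ} (M : Fin n → Fin n → Poly) : Poly → Set where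
  minor : (rows cols : Fin k → Fin n) →
          StrictlyIncreasing rows → StrictlyIncreasing cols →
          Minor k M (det k (λ i j → M (rows i) (cols j)))

adjMatrix : ∀ {n} → (Fin n → Fin n → Bool) → Fin n → Fin n → Poly
adjMatrix adj i j = if adj i j then 1ₚ else 0ₚ

charMatrix : ∀ {n} → (Fin n → Fin n → Bool) → Fin n → Fin n → Poly
charMatrix adj i j =
  (if ⌊ i Fin.≟ j ⌋ then tₚ else 0ₚ) +ₚ (-ₚ adjMatrix adj i j)

A : ∀ {n} → ℕ → (Fin n → Fin n → Bool) → Poly → Set
A k adj = ⟨ Minor k (charMatrix adj) ⟩

-- The graph S_4^r, -r = (a₁,a₂,a₃,a₄).
-- Vertices: Fin (a₁ + (a₂ + (a₃ + a₄))), the first a₁ forming the clique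
-- replacing the apex v₁, then cliques for the leaves v₂, v₃, v₄.

block : ∀ a₁ a₂ a₃ a₄ → Fin (a₁ ℕ.+ (a₂ ℕ.+ (a₃ ℕ.+ a₄))) → Fin 4
block a₁ a₂ a₃ a₄ v with splitAt a₁ v
... | inj₁ _ = zero
... | inj₂ w with splitAt a₂ w
...   | inj₁ _ = suc zero
...   | inj₂ x with splitAt a₃ x
...     | inj₁ _ = suc (suc zero)
...     | inj₂ _ = suc (suc (suc zero))

starAdj : Fin 4 → Fin 4 → Bool
starAdj i j = not ⌊ i Fin.≟ j ⌋ ∧ (⌊ i Fin.≟ zero ⌋ ∨ ⌊ j Fin.≟ zero ⌋)

S4Adj : ∀ a₁ a₂ a₃ a₄ → let n = a₁ ℕ.+ (a₂ ℕ.+ (a₃ ℕ.+ a₄)) in Fin n → Fin n → Bool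
S4Adj a₁ a₂ a₃ a₄ u v =
  not ⌊ u Fin.≟ v ⌋ ∧
  (⌊ block a₁ a₂ a₃ a₄ u Fin.≟ block a₁ a₂ a₃ a₄ v ⌋
    ∨ starAdj (block a₁ a₂ a₃ a₄ u) (block a₁ a₂ a₃ a₄ v))

{-# OPTIONS --safe #-}
-- Reduction modulo ⟨t+1, 2⟩, i.e. evaluation at t = −1 followed by reduction
-- mod 2, is a ring map ℤ[t] → 𝔽₂ whose kernel is exactly ⟨t+1, 2⟩, because
-- p − p(−1) is divisible by t + 1. It sends t I − A(S₄ʳ) to the blow-up of the
-- 4 × 4 matrix N = I + A(K₁,₃) over 𝔽₂: the (u, v) entry only depends on the
-- cliques of u and v. Hence every 4 × 4 minor of t I − A(S₄ʳ) reduces to a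
-- 4 × 4 minor of N with possibly repeated rows and columns, and since the
-- cliques occupy consecutive vertices, the row and column choices are weakly
-- increasing. N has rank 3 over 𝔽₂ (its first row is the sum of the other
-- three), so these 35 × 35 minors all vanish, which is checked by evaluation.
-- Thus A₄(S₄ʳ, t) ⊆ ⟨t+1, 2⟩, an ideal not containing 1.
module Submission where

open import Defs
open import Data.Nat using (ℕ; _≤_)
open import Data.Product using (_×_)
open import Relation.Nullary using (¬_)

open import Data.Bool using (Bool; true; false; T; not; _∧_; _∨_; if_then_else_)
open import Data.Bool.ListAction using (all)
open import Data.Bool.Properties using (T-∧; T-∨)
open import Data.Empty using (⊥-elim)
open import Data.Fin as Fin using (Fin; zero; suc; punchIn; splitAt; toℕ)
open import Data.Fin.Properties
  using (splitAt⁻¹-↑ˡ; splitAt⁻¹-↑ʳ; toℕ-↑ˡ; toℕ-↑ʳ; toℕ<n; ≤∧≢⇒<)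
open import Data.Integer using (ℤ; +_; -[1+_]; _+_; _-_; _*_; -_; ∣_∣; _⊖_)
import Data.Integer.Properties as ℤP
open import Data.Integer.Divisibility.Signed using (_∣_; divides; ∣ᵤ⇒∣)
open import Data.Integer.Tactic.RingSolver using (solve-∀)
open import Data.List using ([]; _∷_; allFin)
open import Data.List.Membership.Propositional.Properties using (∈-allFin)
import Data.List.Relation.Unary.All as All
open import Data.List.Relation.Unary.All.Properties using (all⁺)
import Data.Nat as ℕ
open import Data.Nat.Base using (zero; suc; z≤n; s≤s; parity)
import Data.Nat.Divisibility as ℕ∣
import Data.Nat.Properties as ℕP
open import Data.Parity.Base as ℙ using (Parity; 0ℙ; 1ℙ)
import Data.Parity.Properties as ℙP
open import Data.Product using (_,_)
open import Data.Sum using (inj₁; inj₂)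
open import Data.Unit using (tt)
open import Data.Vec using (Vec; []; _∷_; lookup; tabulate)
open import Data.Vec.Properties using (lookup∘tabulate)
open import Function using (_∘_; Equivalence)
open import Relation.Binary.Core using (_Preserves_⟶_)
open import Relation.Binary.PropositionalEquality
  using (_≡_; refl; sym; trans; cong; cong₂; subst; subst₂; module ≡-Reasoning)
open import Relation.Nullary.Decidable using (⌊_⌋; yes; no; toWitness; fromWitness)

open ≡-Reasoning

parityℤ : ℤ → Parity
parityℤ i = parity ∣ i ∣

parity-suc+suc : ∀ m n → parity (suc m) ℙ.+ parity (suc n) ≡ parity m ℙ.+ parity n
parity-suc+suc m n = begin
  parity (suc m) ℙ.+ parity (suc n) ≡⟨ ℙP.+-homo-+ (suc m) (suc n) ⟨
  parity (suc (m ℕ.+ suc n))        ≡⟨ cong (parity ∘ suc) (ℕP.+-suc m n) ⟩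
  parity (m ℕ.+ n)                  ≡⟨ ℙP.+-homo-+ m n ⟩
  parity m ℙ.+ parity n             ∎

parityℤ-⊖ : ∀ m n → parityℤ (m ⊖ n) ≡ parity m ℙ.+ parity n
parityℤ-⊖ zero    zero    = refl
parityℤ-⊖ zero    (suc n) = refl
parityℤ-⊖ (suc m) zero    = sym (ℙP.+-identityʳ (parity (suc m)))
parityℤ-⊖ (suc m) (suc n) = begin
  parityℤ (suc m ⊖ suc n)           ≡⟨ cong parityℤ (ℤP.[1+m]⊖[1+n]≡m⊖n m n) ⟩
  parityℤ (m ⊖ n)                   ≡⟨ parityℤ-⊖ m n ⟩
  parity m ℙ.+ parity n             ≡⟨ parity-suc+suc m n ⟨
  parity (suc m) ℙ.+ parity (suc n) ∎

parityℤ-+ : ∀ i j → parityℤ (i + j) ≡ parityℤ i ℙ.+ parityℤ j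
parityℤ-+ (+ m)    (+ n)    = ℙP.+-homo-+ m n
parityℤ-+ (+ m)    -[1+ n ] = parityℤ-⊖ m (suc n)
parityℤ-+ -[1+ m ] (+ n)    = trans (parityℤ-⊖ n (suc m)) (ℙP.+-comm (parity n) _)
parityℤ-+ -[1+ m ] -[1+ n ] = trans (ℙP.+-homo-+ m n) (sym (parity-suc+suc m n))

parityℤ-* : ∀ i j → parityℤ (i * j) ≡ parityℤ i ℙ.* parityℤ j
parityℤ-* i j = trans (cong parity (ℤP.abs-* i j)) (ℙP.*-homo-* ∣ i ∣ ∣ j ∣)

parity≡0ℙ⇒2∣ : ∀ n → parity n ≡ 0ℙ → 2 ℕ∣.∣ n
parity≡0ℙ⇒2∣ zero          _  = 2 ℕ∣.∣0
parity≡0ℙ⇒2∣ (suc zero)    ()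
parity≡0ℙ⇒2∣ (suc (suc n)) eq = ℕ∣.∣m∣n⇒∣m+n ℕ∣.∣-refl (parity≡0ℙ⇒2∣ n eq)

parityℤ≡0ℙ⇒2∣ : ∀ i → parityℤ i ≡ 0ℙ → + 2 ∣ i
parityℤ≡0ℙ⇒2∣ i eq = ∣ᵤ⇒∣ (parity≡0ℙ⇒2∣ ∣ i ∣ eq)

≡⇒≈ₚ : ∀ {p q} → p ≡ q → p ≈ₚ q
≡⇒≈ₚ p≡q i = cong (λ r → coeff r i) p≡q

∷-cong : ∀ {a b p q} → a ≡ b → p ≈ₚ q → (a ∷ p) ≈ₚ (b ∷ q)
∷-cong a≡b _   zero    = a≡b
∷-cong _   p≈q (suc i) = p≈q i

coeff-+ₚ : ∀ p q i → coeff (p +ₚ q) i ≡ coeff p i + coeff q i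
coeff-+ₚ []      q       i       = sym (ℤP.+-identityˡ (coeff q i))
coeff-+ₚ (a ∷ p) []      i       = sym (ℤP.+-identityʳ (coeff (a ∷ p) i))
coeff-+ₚ (a ∷ p) (b ∷ q) zero    = refl
coeff-+ₚ (a ∷ p) (b ∷ q) (suc i) = coeff-+ₚ p q i

coeff-scaleₚ : ∀ c p i → coeff (scaleₚ c p) i ≡ c * coeff p i
coeff-scaleₚ c []      i       = sym (ℤP.*-zeroʳ c)
coeff-scaleₚ c (a ∷ p) zero    = refl
coeff-scaleₚ c (a ∷ p) (suc i) = coeff-scaleₚ c p i

+ₚ-cong : ∀ {p p′ q q′} → p ≈ₚ p′ → q ≈ₚ q′ → (p +ₚ q) ≈ₚ (p′ +ₚ q′)
+ₚ-cong {p} {p′} {q} {q′} p≈p′ q≈q′ i = begin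
  coeff (p +ₚ q) i         ≡⟨ coeff-+ₚ p q i ⟩
  coeff p i + coeff q i    ≡⟨ cong₂ _+_ (p≈p′ i) (q≈q′ i) ⟩
  coeff p′ i + coeff q′ i  ≡⟨ coeff-+ₚ p′ q′ i ⟨
  coeff (p′ +ₚ q′) i       ∎

+ₚ-identityʳ : ∀ p → p +ₚ [] ≡ p
+ₚ-identityʳ []      = refl
+ₚ-identityʳ (a ∷ p) = refl

+ₚ-zeroʳ : ∀ p → (p +ₚ constₚ (+ 0)) ≈ₚ p
+ₚ-zeroʳ []      = λ { zero → refl ; (suc i) → refl }
+ₚ-zeroʳ (a ∷ p) = ∷-cong (ℤP.+-identityʳ a) (≡⇒≈ₚ (+ₚ-identityʳ p))

scaleₚ-zero : ∀ p → scaleₚ (+ 0) p ≈ₚ []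
scaleₚ-zero p i = trans (coeff-scaleₚ (+ 0) p i) (ℤP.*-zeroˡ (coeff p i))

scaleₚ-identity : ∀ p → scaleₚ (+ 1) p ≡ p
scaleₚ-identity []      = refl
scaleₚ-identity (a ∷ p) = cong₂ _∷_ (ℤP.*-identityˡ a) (scaleₚ-identity p)

constₚ-*ₚ : ∀ a p → (constₚ a *ₚ p) ≈ₚ scaleₚ a p
constₚ-*ₚ a p = +ₚ-zeroʳ (scaleₚ a p)

tₚ-*ₚ : ∀ p → (tₚ *ₚ p) ≈ₚ (+ 0 ∷ p)
tₚ-*ₚ p = +ₚ-cong {scaleₚ (+ 0) p} {[]} {+ 0 ∷ (constₚ (+ 1) *ₚ p)} {+ 0 ∷ p}
  (scaleₚ-zero p) (∷-cong refl λ i → trans (constₚ-*ₚ (+ 1) p i) (≡⇒≈ₚ (scaleₚ-identity p) i))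

+ₚ-constₚ-cancel : ∀ p c → ((p +ₚ constₚ (- c)) +ₚ constₚ c) ≈ₚ p
+ₚ-constₚ-cancel []      c = λ { zero → ℤP.+-inverseˡ c ; (suc i) → refl }
+ₚ-constₚ-cancel (a ∷ p) c = ∷-cong (cancel a c)
  (≡⇒≈ₚ (trans (+ₚ-identityʳ (p +ₚ [])) (+ₚ-identityʳ p)))
  where
  cancel : ∀ a c → (a + - c) + c ≡ a
  cancel = solve-∀

eval₋₁ : Poly → ℤ
eval₋₁ []      = + 0
eval₋₁ (a ∷ p) = a - eval₋₁ p

eval₋₁-+ₚ : ∀ p q → eval₋₁ (p +ₚ q) ≡ eval₋₁ p + eval₋₁ q
eval₋₁-+ₚ []      q       = sym (ℤP.+-identityˡ (eval₋₁ q))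
eval₋₁-+ₚ (a ∷ p) []      = sym (ℤP.+-identityʳ (eval₋₁ (a ∷ p)))
eval₋₁-+ₚ (a ∷ p) (b ∷ q) = begin
  (a + b) - eval₋₁ (p +ₚ q)        ≡⟨ cong (λ x → (a + b) - x) (eval₋₁-+ₚ p q) ⟩
  (a + b) - (eval₋₁ p + eval₋₁ q)  ≡⟨ interchange a b (eval₋₁ p) (eval₋₁ q) ⟩
  (a - eval₋₁ p) + (b - eval₋₁ q)  ∎
  where
  interchange : ∀ a b x y → (a + b) - (x + y) ≡ (a - x) + (b - y)
  interchange = solve-∀

eval₋₁-scaleₚ : ∀ c p → eval₋₁ (scaleₚ c p) ≡ c * eval₋₁ p
eval₋₁-scaleₚ c []      = sym (ℤP.*-zeroʳ c)
eval₋₁-scaleₚ c (a ∷ p) = begin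
  c * a - eval₋₁ (scaleₚ c p)  ≡⟨ cong (λ x → c * a - x) (eval₋₁-scaleₚ c p) ⟩
  c * a - c * eval₋₁ p         ≡⟨ distrib c a (eval₋₁ p) ⟩
  c * (a - eval₋₁ p)           ∎
  where
  distrib : ∀ c a x → c * a - c * x ≡ c * (a - x)
  distrib = solve-∀

eval₋₁-*ₚ : ∀ p q → eval₋₁ (p *ₚ q) ≡ eval₋₁ p * eval₋₁ q
eval₋₁-*ₚ []      q = sym (ℤP.*-zeroˡ (eval₋₁ q))
eval₋₁-*ₚ (a ∷ p) q = begin
  eval₋₁ (scaleₚ a q +ₚ (+ 0 ∷ (p *ₚ q)))          ≡⟨ eval₋₁-+ₚ (scaleₚ a q) _ ⟩
  eval₋₁ (scaleₚ a q) + (+ 0 - eval₋₁ (p *ₚ q))   ≡⟨ cong₂ (λ x y → x + (+ 0 - y))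
                                                       (eval₋₁-scaleₚ a q) (eval₋₁-*ₚ p q) ⟩
  a * eval₋₁ q + (+ 0 - eval₋₁ p * eval₋₁ q)      ≡⟨ distrib a (eval₋₁ p) (eval₋₁ q) ⟩
  (a - eval₋₁ p) * eval₋₁ q                        ∎
  where
  distrib : ∀ a x y → a * y + (+ 0 - x * y) ≡ (a - x) * y
  distrib = solve-∀

eval₋₁-≈ₚ : ∀ p q → p ≈ₚ q → eval₋₁ p ≡ eval₋₁ q
eval₋₁-≈ₚ []      []      _   = refl
eval₋₁-≈ₚ []      (b ∷ q) p≈q = cong₂ _-_ (p≈q zero) (eval₋₁-≈ₚ [] q (p≈q ∘ suc))
eval₋₁-≈ₚ (a ∷ p) []      p≈q = cong₂ _-_ (p≈q zero) (eval₋₁-≈ₚ p [] (p≈q ∘ suc))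
eval₋₁-≈ₚ (a ∷ p) (b ∷ q) p≈q = cong₂ _-_ (p≈q zero) (eval₋₁-≈ₚ p q (p≈q ∘ suc))

residue : Poly → Parity
residue p = parityℤ (eval₋₁ p)

residue-+ₚ : ∀ p q → residue (p +ₚ q) ≡ residue p ℙ.+ residue q
residue-+ₚ p q = trans (cong parityℤ (eval₋₁-+ₚ p q)) (parityℤ-+ (eval₋₁ p) (eval₋₁ q))

residue-*ₚ : ∀ p q → residue (p *ₚ q) ≡ residue p ℙ.* residue q
residue-*ₚ p q = trans (cong parityℤ (eval₋₁-*ₚ p q)) (parityℤ-* (eval₋₁ p) (eval₋₁ q))

⟨⟩-least : ∀ {S T} → S ⊆ᵢ ⟨ T ⟩ → ⟨ S ⟩ ⊆ᵢ ⟨ T ⟩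
⟨⟩-least S⊆T p (gen s)    = S⊆T p s
⟨⟩-least S⊆T _ zro        = zro
⟨⟩-least S⊆T _ (add x y)  = add (⟨⟩-least S⊆T _ x) (⟨⟩-least S⊆T _ y)
⟨⟩-least S⊆T _ (mul r x)  = mul r (⟨⟩-least S⊆T _ x)
⟨⟩-least S⊆T _ (resp e x) = resp e (⟨⟩-least S⊆T _ x)

residue-⟨t+1,2⟩ : ∀ {p} → ⟨ Gens-t+1,2 ⟩ p → residue p ≡ 0ℙ
residue-⟨t+1,2⟩ (gen g-t+1)             = refl
residue-⟨t+1,2⟩ (gen g-2)               = refl
residue-⟨t+1,2⟩ zro                     = refl
residue-⟨t+1,2⟩ (add {p} {q} x y)       =
  trans (residue-+ₚ p q) (cong₂ ℙ._+_ (residue-⟨t+1,2⟩ x) (residue-⟨t+1,2⟩ y))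
residue-⟨t+1,2⟩ (mul {p} r x)           =
  trans (residue-*ₚ r p) (trans (cong (residue r ℙ.*_) (residue-⟨t+1,2⟩ x)) (ℙP.*-zeroʳ (residue r)))
residue-⟨t+1,2⟩ (resp {p} {q} p≈q x)    =
  trans (cong parityℤ (sym (eval₋₁-≈ₚ p q p≈q))) (residue-⟨t+1,2⟩ x)

sub-eval₋₁∈⟨t+1⟩ : ∀ {S} → S (tₚ +ₚ 1ₚ) → ∀ p → ⟨ S ⟩ (p +ₚ constₚ (- eval₋₁ p))
sub-eval₋₁∈⟨t+1⟩ t+1∈S []      = resp (λ { zero → refl ; (suc i) → refl }) zro
sub-eval₋₁∈⟨t+1⟩ {S} t+1∈S (a ∷ p) = resp shape (add t·rest c·[t+1])
  where
  c = eval₋₁ p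
  t·rest : ⟨ S ⟩ (+ 0 ∷ (p +ₚ constₚ (- c)))
  t·rest = resp (tₚ-*ₚ (p +ₚ constₚ (- c))) (mul tₚ (sub-eval₋₁∈⟨t+1⟩ t+1∈S p))
  c·[t+1] : ⟨ S ⟩ (c ∷ c ∷ [])
  c·[t+1] = resp (λ i → trans (constₚ-*ₚ c (tₚ +ₚ 1ₚ) i) (c*1∷c*1≈c∷c i))
                 (mul (constₚ c) (gen t+1∈S))
    where
    c*1∷c*1≈c∷c : (c * + 1 ∷ c * + 1 ∷ []) ≈ₚ (c ∷ c ∷ [])
    c*1∷c*1≈c∷c = ∷-cong (ℤP.*-identityʳ c) (∷-cong (ℤP.*-identityʳ c) (λ _ → refl))
  constant : ∀ a c → + 0 + c ≡ a + - (a - c)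
  constant = solve-∀
  shape : ((+ 0 ∷ (p +ₚ constₚ (- c))) +ₚ (c ∷ c ∷ [])) ≈ₚ ((a ∷ p) +ₚ constₚ (- (a - c)))
  shape = ∷-cong (constant a c) λ i →
    trans (+ₚ-constₚ-cancel p c i) (≡⇒≈ₚ (sym (+ₚ-identityʳ p)) i)

residue≡0ℙ⇒∈⟨t+1,2⟩ : ∀ p → residue p ≡ 0ℙ → ⟨ Gens-t+1,2 ⟩ p
residue≡0ℙ⇒∈⟨t+1,2⟩ p res≡0 with parityℤ≡0ℙ⇒2∣ (eval₋₁ p) res≡0
... | divides k p[-1]≡k*2 =
  resp (+ₚ-constₚ-cancel p (eval₋₁ p)) (add (sub-eval₋₁∈⟨t+1⟩ g-t+1 p) p[-1]∈⟨2⟩)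
  where
  p[-1]∈⟨2⟩ : ⟨ Gens-t+1,2 ⟩ (constₚ (eval₋₁ p))
  p[-1]∈⟨2⟩ = subst (⟨ Gens-t+1,2 ⟩ ∘ constₚ) (sym p[-1]≡k*2)
    (resp (constₚ-*ₚ k (constₚ (+ 2))) (mul (constₚ k) (gen g-2)))

sumℙ : ∀ {k} → (Fin k → Parity) → Parity
sumℙ {zero}  f = 0ℙ
sumℙ {suc k} f = f zero ℙ.+ sumℙ (f ∘ suc)

sumℙ-cong : ∀ {k} {f g : Fin k → Parity} → (∀ j → f j ≡ g j) → sumℙ f ≡ sumℙ g
sumℙ-cong {zero}  f≡g = refl
sumℙ-cong {suc k} f≡g = cong₂ ℙ._+_ (f≡g zero) (sumℙ-cong (f≡g ∘ suc))

-- Laplace expansion along the first row, as for det; the signs are 1 in 𝔽₂.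
detℙ : ∀ k → (Fin k → Fin k → Parity) → Parity
detℙ zero    M = 1ℙ
detℙ (suc k) M = sumℙ (λ j → M zero j ℙ.* detℙ k (λ r c → M (suc r) (punchIn j c)))

detℙ-cong : ∀ k {M N : Fin k → Fin k → Parity} → (∀ i j → M i j ≡ N i j) → detℙ k M ≡ detℙ k N
detℙ-cong zero    M≡N = refl
detℙ-cong (suc k) M≡N = sumℙ-cong λ j →
  cong₂ ℙ._*_ (M≡N zero j) (detℙ-cong k λ r c → M≡N (suc r) (punchIn j c))

residue-sumFin : ∀ {k} (f : Fin k → Poly) → residue (sumFin f) ≡ sumℙ (residue ∘ f)
residue-sumFin {zero}  f = refl
residue-sumFin {suc k} f =
  trans (residue-+ₚ (f zero) _) (cong (residue (f zero) ℙ.+_) (residue-sumFin (f ∘ suc)))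

residue-signₚ : ∀ n → residue (signₚ n) ≡ 1ℙ
residue-signₚ zero          = refl
residue-signₚ (suc zero)    = refl
residue-signₚ (suc (suc n)) = residue-signₚ n

residue-det : ∀ k (M : Fin k → Fin k → Poly) →
              residue (det k M) ≡ detℙ k (λ i j → residue (M i j))
residue-det zero    M = refl
residue-det (suc k) M = trans (residue-sumFin term) (sumℙ-cong λ j → begin
  residue (signₚ (toℕ j) *ₚ M zero j *ₚ det k (submatrix j))
    ≡⟨ residue-*ₚ (signₚ (toℕ j) *ₚ M zero j) _ ⟩
  residue (signₚ (toℕ j) *ₚ M zero j) ℙ.* residue (det k (submatrix j))
    ≡⟨ cong₂ ℙ._*_ (residue-*ₚ (signₚ (toℕ j)) (M zero j)) (residue-det k (submatrix j)) ⟩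
  residue (signₚ (toℕ j)) ℙ.* residue (M zero j) ℙ.* detℙ k (λ r c → residue (submatrix j r c))
    ≡⟨ cong (λ s → s ℙ.* residue (M zero j) ℙ.* detℙ k (λ r c → residue (submatrix j r c)))
            (residue-signₚ (toℕ j)) ⟩
  residue (M zero j) ℙ.* detℙ k (λ r c → residue (submatrix j r c)) ∎)
  where
  submatrix : Fin (suc k) → Fin k → Fin k → Poly
  submatrix j r c = M (suc r) (punchIn j c)
  term : Fin (suc k) → Poly
  term j = signₚ (toℕ j) *ₚ M zero j *ₚ det k (submatrix j)

toParity : Bool → Parity
toParity false = 0ℙ
toParity true  = 1ℙ

closedAdj : ∀ {n} → (Fin n → Fin n → Bool) → Fin n → Fin n → Bool
closedAdj adj i j = ⌊ i Fin.≟ j ⌋ ∨ adj i j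

closedAdj-refl : ∀ {n} (adj : Fin n → Fin n → Bool) i → T (closedAdj adj i i)
closedAdj-refl adj i =
  Equivalence.from (T-∨ {⌊ i Fin.≟ i ⌋} {adj i i}) (inj₁ (fromWitness {a? = i Fin.≟ i} refl))

residue-charMatrix : ∀ {n} (adj : Fin n → Fin n → Bool) i j →
                     residue (charMatrix adj i j) ≡ toParity ⌊ i Fin.≟ j ⌋ ℙ.+ toParity (adj i j)
residue-charMatrix adj i j = residue-entry ⌊ i Fin.≟ j ⌋ (adj i j)
  where
  residue-entry : ∀ d a → residue ((if d then tₚ else 0ₚ) +ₚ (-ₚ (if a then 1ₚ else 0ₚ)))
                          ≡ toParity d ℙ.+ toParity a
  residue-entry true  true  = refl
  residue-entry true  false = refl
  residue-entry false true  = refl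
  residue-entry false false = refl

toParity-+-not∧ : ∀ e y → (T e → T y) → toParity e ℙ.+ toParity (not e ∧ y) ≡ toParity y
toParity-+-not∧ true  true  _   = refl
toParity-+-not∧ true  false e⇒y = ⊥-elim (e⇒y tt)
toParity-+-not∧ false y     _   = refl

-- Modulo ⟨t+1, 2⟩ the diagonal t and the −1's inside a clique agree, so the
-- residue of t I − A(S₄ʳ) is the blow-up of I + A(K₁,₃).
residue-charMatrix-S4 : ∀ a₁ a₂ a₃ a₄ u v →
  residue (charMatrix (S4Adj a₁ a₂ a₃ a₄) u v)
    ≡ toParity (closedAdj starAdj (block a₁ a₂ a₃ a₄ u) (block a₁ a₂ a₃ a₄ v))
residue-charMatrix-S4 a₁ a₂ a₃ a₄ u v =
  trans (residue-charMatrix (S4Adj a₁ a₂ a₃ a₄) u v)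
        (toParity-+-not∧ ⌊ u Fin.≟ v ⌋ (closedAdj starAdj (bl u) (bl v)) sameBlock)
  where
  bl = block a₁ a₂ a₃ a₄
  sameBlock : T ⌊ u Fin.≟ v ⌋ → T (closedAdj starAdj (bl u) (bl v))
  sameBlock u≡v = subst (λ w → T (closedAdj starAdj (bl u) (bl w))) (toWitness u≡v)
                        (closedAdj-refl starAdj (bl u))

splitAt-inj₂≰inj₁ : ∀ m {n} {u v : Fin (m ℕ.+ n)} {x y} →
                    splitAt m u ≡ inj₂ x → splitAt m v ≡ inj₁ y → ¬ (u Fin.≤ v)
splitAt-inj₂≰inj₁ m {n} {x = x} {y} u≡m+x v≡y u≤v
  rewrite sym (splitAt⁻¹-↑ʳ u≡m+x) | sym (splitAt⁻¹-↑ˡ v≡y) =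
  ℕP.<⇒≱ (subst (ℕ._< m) (sym (toℕ-↑ˡ y n)) (toℕ<n y))
         (ℕP.≤-trans (ℕP.m≤m+n m (toℕ x)) (subst (ℕ._≤ _) (toℕ-↑ʳ m x) u≤v))

splitAt-inj₂-mono : ∀ m {n} {u v : Fin (m ℕ.+ n)} {x y} →
                    splitAt m u ≡ inj₂ x → splitAt m v ≡ inj₂ y → u Fin.≤ v → x Fin.≤ y
splitAt-inj₂-mono m {x = x} {y} u≡m+x v≡m+y u≤v
  rewrite sym (splitAt⁻¹-↑ʳ u≡m+x) | sym (splitAt⁻¹-↑ʳ v≡m+y) =
  ℕP.+-cancelˡ-≤ m (toℕ x) (toℕ y) (subst₂ ℕ._≤_ (toℕ-↑ʳ m x) (toℕ-↑ʳ m y) u≤v)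

block-mono : ∀ a₁ a₂ a₃ a₄ → block a₁ a₂ a₃ a₄ Preserves Fin._≤_ ⟶ Fin._≤_
block-mono a₁ a₂ a₃ a₄ {u} {v} u≤v with splitAt a₁ u in u₁ | splitAt a₁ v in v₁
... | inj₁ _ | _      = z≤n
... | inj₂ _ | inj₁ _ = ⊥-elim (splitAt-inj₂≰inj₁ a₁ u₁ v₁ u≤v)
... | inj₂ w | inj₂ w′ with splitAt-inj₂-mono a₁ u₁ v₁ u≤v
...   | w≤w′ with splitAt a₂ w in w₂ | splitAt a₂ w′ in w′₂
...     | inj₁ _ | inj₁ _  = s≤s z≤n
...     | inj₂ _ | inj₁ _  = ⊥-elim (splitAt-inj₂≰inj₁ a₂ w₂ w′₂ w≤w′)
...     | inj₁ _ | inj₂ x′ with splitAt a₃ x′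
...       | inj₁ _ = s≤s z≤n
...       | inj₂ _ = s≤s z≤n
block-mono a₁ a₂ a₃ a₄ {u} {v} u≤v
    | inj₂ w | inj₂ w′ | w≤w′ | inj₂ x | inj₂ x′ with splitAt-inj₂-mono a₂ w₂ w′₂ w≤w′
...       | x≤x′ with splitAt a₃ x in x₃ | splitAt a₃ x′ in x′₃
...         | inj₁ _ | inj₁ _ = s≤s (s≤s z≤n)
...         | inj₁ _ | inj₂ _ = s≤s (s≤s z≤n)
...         | inj₂ _ | inj₁ _ = ⊥-elim (splitAt-inj₂≰inj₁ a₃ x₃ x′₃ x≤x′)
...         | inj₂ _ | inj₂ _ = s≤s (s≤s (s≤s z≤n))

strictlyIncreasing⇒mono : ∀ {k n} {f : Fin k → Fin n} →
                          StrictlyIncreasing f → f Preserves Fin._≤_ ⟶ Fin._≤_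
strictlyIncreasing⇒mono f↑ {i} {j} i≤j with i Fin.≟ j
... | yes refl = ℕP.≤-refl
... | no  i≢j  = ℕP.<⇒≤ (f↑ i j (≤∧≢⇒< i≤j i≢j))

allVecs : ∀ {m} k → (Vec (Fin m) k → Bool) → Bool
allVecs zero    P = P []
allVecs (suc k) P = all (λ x → allVecs k (P ∘ (x ∷_))) (allFin _)

allVecs-sound : ∀ {m} k {P : Vec (Fin m) k → Bool} → T (allVecs k P) → ∀ v → T (P v)
allVecs-sound zero    P-holds []      = P-holds
allVecs-sound (suc k) P-holds (x ∷ v) =
  allVecs-sound k (All.lookup (all⁺ _ (allFin _) P-holds) (∈-allFin x)) v

ascending : ∀ {m k} → Vec (Fin m) k → Bool
ascending []          = true
ascending (x ∷ [])    = true
ascending (x ∷ y ∷ v) = ⌊ x Fin.≤? y ⌋ ∧ ascending (y ∷ v)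

ascending-tabulate : ∀ {m k} {f : Fin k → Fin m} →
                     f Preserves Fin._≤_ ⟶ Fin._≤_ → T (ascending (tabulate f))
ascending-tabulate {k = zero}        f-mono = tt
ascending-tabulate {k = suc zero}    f-mono = tt
ascending-tabulate {k = suc (suc k)} f-mono = Equivalence.from T-∧
  (fromWitness (f-mono z≤n) , ascending-tabulate (f-mono ∘ s≤s))

T-not∨ : ∀ {a b} → T (not a ∨ b) → T a → T b
T-not∨ {true} b-holds _ = b-holds

allAscending : ∀ {m k} → (Vec (Fin m) k → Bool) → Bool
allAscending P = allVecs _ λ v → not (ascending v) ∨ P v

allAscending-sound : ∀ {m k} (P : Vec (Fin m) k → Bool) → T (allAscending P) →
                     ∀ {f} → f Preserves Fin._≤_ ⟶ Fin._≤_ → T (P (tabulate f))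
allAscending-sound P P-holds {f} f-mono =
  T-not∨ (allVecs-sound _ P-holds (tabulate f)) (ascending-tabulate f-mono)

starMinor : (Fin 4 → Fin 4) → (Fin 4 → Fin 4) → Parity
starMinor F G = detℙ 4 (λ i j → toParity (closedAdj starAdj (F i) (G j)))

starMinorVanishes : Vec (Fin 4) 4 → Vec (Fin 4) 4 → Bool
starMinorVanishes u w = ⌊ starMinor (lookup u) (lookup w) ℙP.≟ 0ℙ ⌋

-- Checked by evaluation, on 35 × 35 pairs of ascending index vectors.
ascendingStarMinorsVanish : T (allAscending λ u → allAscending (starMinorVanishes u))
ascendingStarMinorsVanish = _

starMinor-mono≡0ℙ : ∀ {F G} → F Preserves Fin._≤_ ⟶ Fin._≤_ → G Preserves Fin._≤_ ⟶ Fin._≤_ →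
                    starMinor F G ≡ 0ℙ
starMinor-mono≡0ℙ {F} {G} F-mono G-mono = begin
  starMinor F G
    ≡⟨ detℙ-cong 4 (λ i j → cong₂ (λ b c → toParity (closedAdj starAdj b c))
                                  (sym (lookup∘tabulate F i)) (sym (lookup∘tabulate G j))) ⟩
  starMinor (lookup (tabulate F)) (lookup (tabulate G))
    ≡⟨ toWitness (allAscending-sound (starMinorVanishes (tabulate F)) columnsVanish G-mono) ⟩
  0ℙ ∎
  where
  columnsVanish : T (allAscending (starMinorVanishes (tabulate F)))
  columnsVanish = allAscending-sound (λ u → allAscending (starMinorVanishes u))
                                     ascendingStarMinorsVanish F-mono

residue-S4-minor : ∀ a₁ a₂ a₃ a₄ {p} → Minor 4 (charMatrix (S4Adj a₁ a₂ a₃ a₄)) p → residue p ≡ 0ℙ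
residue-S4-minor a₁ a₂ a₃ a₄ (minor rows cols rows↑ cols↑) = begin
  residue (det 4 (λ i j → charMatrix (S4Adj a₁ a₂ a₃ a₄) (rows i) (cols j)))
    ≡⟨ residue-det 4 (λ i j → charMatrix (S4Adj a₁ a₂ a₃ a₄) (rows i) (cols j)) ⟩
  detℙ 4 (λ i j → residue (charMatrix (S4Adj a₁ a₂ a₃ a₄) (rows i) (cols j)))
    ≡⟨ detℙ-cong 4 (λ i j → residue-charMatrix-S4 a₁ a₂ a₃ a₄ (rows i) (cols j)) ⟩
  starMinor (bl ∘ rows) (bl ∘ cols)
    ≡⟨ starMinor-mono≡0ℙ (bl-mono ∘ strictlyIncreasing⇒mono rows↑)
                          (bl-mono ∘ strictlyIncreasing⇒mono cols↑) ⟩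
  0ℙ ∎
  where
  bl = block a₁ a₂ a₃ a₄
  bl-mono = block-mono a₁ a₂ a₃ a₄

mainTheorem11 : (a₁ a₂ a₃ a₄ : ℕ) → 1 ≤ a₁ → 1 ≤ a₂ → 1 ≤ a₃ → 1 ≤ a₄ →
    ¬ Trivial (A 4 (S4Adj a₁ a₂ a₃ a₄))
      × (A 4 (S4Adj a₁ a₂ a₃ a₄) ⊆ᵢ ⟨ Gens-t+1,2 ⟩)
mainTheorem11 a₁ a₂ a₃ a₄ _ _ _ _ = nontrivial , A₄⊆⟨t+1,2⟩
  where
  A₄⊆⟨t+1,2⟩ : A 4 (S4Adj a₁ a₂ a₃ a₄) ⊆ᵢ ⟨ Gens-t+1,2 ⟩
  A₄⊆⟨t+1,2⟩ = ⟨⟩-least λ p p-minor →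
    residue≡0ℙ⇒∈⟨t+1,2⟩ p (residue-S4-minor a₁ a₂ a₃ a₄ p-minor)
  nontrivial : ¬ Trivial (A 4 (S4Adj a₁ a₂ a₃ a₄))
  nontrivial trivial with residue-⟨t+1,2⟩ (A₄⊆⟨t+1,2⟩ 1ₚ (trivial 1ₚ))
  ... | ()
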